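{- Let $s \geq 2$ and $b_0, b_1, \dots, b_{s-1} \geq 1$ be integers, and let $G \in \mathcal{G}_{1}(b_0, b_1, \dots, b_{s-1})$. Then $G$ is $3$-$\gamma_{c}$-critical.
   Context: A set $D \subseteq V(G)$ is a connected dominating set of $G$ if every vertex of $G$ is in $D$ or adjacent to a vertex of $D$, and $G[D]$ is connected; $\gamma_{c}(G)$ is the minimum size of such a set. For non-adjacent $u,v$, $G+uv$ is $G$ with edge $uv$ added. $G$ is $3$-$\gamma_{c}$-critical if $\gamma_{c}(G)=3$ and $\gamma_{c}(G+uv)<3$ for every pair of non-adjacent vertices $u,v$. The class $\mathcal{G}_{1}(b_0, \dots, b_{s-1})$: take pairwise disjoint vertex sets $\{a_0, a_1, \dots, a_s\}$, $\{x\}$, $B_0, B_1, \dots, B_{s-1}$ with $|B_i| = b_i \geq 1$, and fix a vertex $b \in B_0$. The graph $G$ has vertex set $\{a_0,\dots,a_s, x\} \cup B_0 \cup \dots \cup B_{s-1}$ and exactly the following edges: $a_0$ is adjacent to $x$ and to every vertex of $\bigcup_{j=0}^{s-1} B_j$; for $1 \leq i \leq s-1$, $a_i$ is adjacent to every vertex of $\bigcup_{j=0}^{s-1} B_j \setminus B_i$; $a_s$ is adjacent to every vertex of $\bigcup_{j=1}^{s-1} B_j$; $x$ is adjacent to every vertex of $V(G) \setminus \{x, b, a_s\}$; $\bigcup_{j=1}^{s-1} B_j$ is a clique; $B_0$ is a clique. The class consists of all graphs (up to isomorphism) obtained this way. -}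

module Defs where

open import Data.Nat using (ℕ; zero; suc; _≤_; _<_)
open import Data.Fin using (Fin; toℕ)
open import Data.Fin.Subset using (Subset; _∈_; ∣_∣)
open import Data.Product using (Σ; ∃; ∃-syntax; _×_; _,_; proj₁)
open import Data.Sum using (_⊎_; inj₁; inj₂)
open import Data.Empty using (⊥)
open import Data.Unit using (⊤)
open import Relation.Nullary using (¬_)
open import Relation.Binary.PropositionalEquality using (_≡_; _≢_; refl; trans; sym)
open import Function.Bundles using (_⤖_; _⇔_; Bijection)

record Graph : Set₁ where
  field
    n       : ℕ
    Adj     : Fin n → Fin n → Set
    adj-sym : ∀ {u v} → Adj u v → Adj v u
    irrefl  : ∀ {u} → ¬ Adj u u
open Graph public

addEdge : (G : Graph) (u v : Fin (n G)) → u ≢ v → Graph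
addEdge G u v u≢v = record
  { n       = n G
  ; Adj     = A
  ; adj-sym = symm
  ; irrefl  = irr
  }
  where
  A : Fin (n G) → Fin (n G) → Set
  A x y = Adj G x y ⊎ ((x ≡ u × y ≡ v) ⊎ (x ≡ v × y ≡ u))
  symm : ∀ {x y} → A x y → A y x
  symm (inj₁ a) = inj₁ (adj-sym G a)
  symm (inj₂ (inj₁ (p , q))) = inj₂ (inj₂ (q , p))
  symm (inj₂ (inj₂ (p , q))) = inj₂ (inj₁ (q , p))
  irr : ∀ {x} → ¬ A x x
  irr (inj₁ a) = irrefl G a
  irr (inj₂ (inj₁ (p , q))) = u≢v (trans (sym p) q)
  irr (inj₂ (inj₂ (p , q))) = u≢v (trans (sym q) p)

module _ (G : Graph) where

  Dominating : Subset (n G) → Set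
  Dominating D = ∀ v → v ∈ D ⊎ (∃[ u ] (u ∈ D × Adj G u v))

  -- walks in the induced subgraph G[D] (all vertices, including the
  -- start, are required to lie in D by the users below)
  data WalkIn (D : Subset (n G)) : Fin (n G) → Fin (n G) → Set where
    here : ∀ {u} → WalkIn D u u
    step : ∀ {u w v} → Adj G u w → w ∈ D → WalkIn D w v → WalkIn D u v

  InducedConnected : Subset (n G) → Set
  InducedConnected D = ∀ u v → u ∈ D → v ∈ D → WalkIn D u v

  IsCDS : Subset (n G) → Set
  IsCDS D = Dominating D × InducedConnected D

  γc≡ : ℕ → Set
  γc≡ k = (∃[ D ] (IsCDS D × ∣ D ∣ ≡ k)) × (∀ D → IsCDS D → k ≤ ∣ D ∣)

  γc< : ℕ → Set
  γc< k = ∃[ D ] (IsCDS D × ∣ D ∣ < k)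

ThreeCritical : Graph → Set
ThreeCritical G =
  γc≡ G 3 ×
  (∀ u v → (u≢v : u ≢ v) → ¬ Adj G u v → γc< (addEdge G u v u≢v) 3)

module Construction (s : ℕ) (b : Fin s → ℕ) where

  data Vtx : Set where
    a  : Fin (suc s) → Vtx
    x  : Vtx
    bv : (j : Fin s) → Fin (b j) → Vtx

  BIndex : Set
  BIndex = Σ (Fin s) (λ j → Fin (b j))

  -- one-directional listing of the edges; the special vertex b ∈ B₀ is β
  module _ (β : BIndex) where

    E : Vtx → Vtx → Set
    E (a i) x = toℕ i < s
    E (a i) (bv j k) =
      (toℕ i ≡ 0) ⊎ ((toℕ i < s × toℕ j ≢ toℕ i) ⊎ (toℕ i ≡ s × 1 ≤ toℕ j))
    E x (bv j k) = ¬ ((j , k) ≡ β)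
    E (bv j k) (bv j′ k′) =
      ¬ (_≡_ {A = BIndex} (j , k) (j′ , k′)) ×
      ((1 ≤ toℕ j × 1 ≤ toℕ j′) ⊎ (toℕ j ≡ 0 × toℕ j′ ≡ 0))
    E _ _ = ⊥

    AdjC : Vtx → Vtx → Set
    AdjC u v = E u v ⊎ E v u

  IsoToConstruction : Graph → BIndex → Set
  IsoToConstruction G β =
    Σ (Fin (n G) ⤖ Vtx) λ f →
      ∀ u v → Adj G u v ⇔ AdjC β (Bijection.to f u) (Bijection.to f v)

In𝒢₁ : (s : ℕ) (b : Fin s → ℕ) → Graph → Set
In𝒢₁ s b G =
  Σ (Construction.BIndex s b) λ β →
    (toℕ (proj₁ β) ≡ 0) × Construction.IsoToConstruction s b G β

-- γ_c ≤ 3: a₀ – x – c with c ∈ B₁ is a path whose closed neighbourhoods cover G.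
-- γ_c ≥ 3: a connected dominating set D meets N[b] ⊆ {a₀,…,a_{s-1}} ∪ B₀ and
-- N[a_s] ⊆ {a_s} ∪ B₁ ∪ … ∪ B_{s-1}.  These sets are disjoint, so D has distinct y, z;
-- if they are non-adjacent, the walk between them inside D supplies a third vertex,
-- and the only adjacent possibility is y = a_i, z ∈ B_j with j ∉ {0, i}, where the
-- dominator of a_j is a third vertex.
-- Criticality: for each non-edge uv, G + uv has an edge pq with N[p] ∪ N[q] = V(G),
-- found by a case analysis on the kinds of u and v.
module Submission where

open import Defs
open import Data.Bool using (true; false)
open import Data.Empty using (⊥-elim)
open import Data.Fin using (Fin; toℕ; fromℕ; fromℕ<; inject₁) renaming (zero to fzero)
open import Data.Fin.Properties using (toℕ-injective; toℕ<n; toℕ≤pred[n]; toℕ-fromℕ; toℕ-fromℕ<; toℕ-inject₁)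
  renaming (_≟_ to _≟ᶠ_)
open import Data.Fin.Subset using (Subset; _∈_; ∣_∣; ⁅_⁆; _∪_; _-_)
open import Data.Fin.Subset.Properties
  using (x∈⁅x⁆; x∈⁅y⁆⇒x≡y; x∈p∪q⁺; x∈p∪q⁻; x∈p⇒∣p-x∣<∣p∣; x∈p∧x≢y⇒x∈p-y; ∣⁅x⁆∣≡1)
open import Data.Nat using (ℕ; suc; _≤_; _<_; _+_; z≤n; s≤s)
open import Data.Nat.Properties
  using (≤-refl; ≤-trans; ≤-antisym; +-suc; +-monoʳ-≤; n≤1+n; <-irrefl; n>0⇒n≢0; n≢0⇒n>0; ≤∧≢⇒<)
  renaming (_≟_ to _≟ⁿ_)
open import Data.Product using (∃; ∃₂; ∃-syntax; _×_; _,_; proj₁; proj₂)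
open import Data.Product.Properties using (≡-dec)
open import Data.Sum using (_⊎_; inj₁; inj₂; [_,_])
open import Data.Vec using ([]; _∷_)
open import Function.Bundles using (Inverse; Injection; _↔_; Equivalence)
open import Function.Properties.Inverse using (↔⇒↣; ↔-sym)
open import Function.Properties.Bijection using (⤖⇒↔)
open import Relation.Nullary using (¬_; yes; no)
open import Relation.Binary.PropositionalEquality using (_≡_; _≢_; refl; sym; trans; cong; subst; subst₂)

∣p∪q∣≤∣p∣+∣q∣ : ∀ {m} (p q : Subset m) → ∣ p ∪ q ∣ ≤ ∣ p ∣ + ∣ q ∣
∣p∪q∣≤∣p∣+∣q∣ []          []          = z≤n
∣p∪q∣≤∣p∣+∣q∣ (true ∷ p)  (true ∷ q)  =
  s≤s (≤-trans (∣p∪q∣≤∣p∣+∣q∣ p q) (+-monoʳ-≤ ∣ p ∣ (n≤1+n ∣ q ∣)))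
∣p∪q∣≤∣p∣+∣q∣ (true ∷ p)  (false ∷ q) = s≤s (∣p∪q∣≤∣p∣+∣q∣ p q)
∣p∪q∣≤∣p∣+∣q∣ (false ∷ p) (true ∷ q)  =
  subst (suc ∣ p ∪ q ∣ ≤_) (sym (+-suc ∣ p ∣ ∣ q ∣)) (s≤s (∣p∪q∣≤∣p∣+∣q∣ p q))
∣p∪q∣≤∣p∣+∣q∣ (false ∷ p) (false ∷ q) = ∣p∪q∣≤∣p∣+∣q∣ p q

∣⁅x⁆∪⁅y⁆∣≤2 : ∀ {m} (x y : Fin m) → ∣ ⁅ x ⁆ ∪ ⁅ y ⁆ ∣ ≤ 2
∣⁅x⁆∪⁅y⁆∣≤2 x y = ≤-trans (∣p∪q∣≤∣p∣+∣q∣ ⁅ x ⁆ ⁅ y ⁆)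
  (subst₂ (λ m n → m + n ≤ 2) (sym (∣⁅x⁆∣≡1 x)) (sym (∣⁅x⁆∣≡1 y)) ≤-refl)

∣⁅x⁆∪⁅y⁆∪⁅z⁆∣≤3 : ∀ {m} (x y z : Fin m) → ∣ ⁅ x ⁆ ∪ ⁅ y ⁆ ∪ ⁅ z ⁆ ∣ ≤ 3
∣⁅x⁆∪⁅y⁆∪⁅z⁆∣≤3 x y z = ≤-trans (∣p∪q∣≤∣p∣+∣q∣ ⁅ x ⁆ (⁅ y ⁆ ∪ ⁅ z ⁆))
  (subst (λ m → m + ∣ ⁅ y ⁆ ∪ ⁅ z ⁆ ∣ ≤ 3) (sym (∣⁅x⁆∣≡1 x)) (s≤s (∣⁅x⁆∪⁅y⁆∣≤2 y z)))

x∈⁅x⁆∪⁅y⁆ : ∀ {m} (x y : Fin m) → x ∈ ⁅ x ⁆ ∪ ⁅ y ⁆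
x∈⁅x⁆∪⁅y⁆ x y = x∈p∪q⁺ (inj₁ (x∈⁅x⁆ x))

y∈⁅x⁆∪⁅y⁆ : ∀ {m} (x y : Fin m) → y ∈ ⁅ x ⁆ ∪ ⁅ y ⁆
y∈⁅x⁆∪⁅y⁆ x y = x∈p∪q⁺ (inj₂ (x∈⁅x⁆ y))

∈⁅x⁆∪⁅y⁆⇒ : ∀ {m} {x y v : Fin m} → v ∈ ⁅ x ⁆ ∪ ⁅ y ⁆ → v ≡ x ⊎ v ≡ y
∈⁅x⁆∪⁅y⁆⇒ {x = x} {y} v∈ with x∈p∪q⁻ ⁅ x ⁆ ⁅ y ⁆ v∈
... | inj₁ v∈⁅x⁆ = inj₁ (x∈⁅y⁆⇒x≡y x v∈⁅x⁆)
... | inj₂ v∈⁅y⁆ = inj₂ (x∈⁅y⁆⇒x≡y y v∈⁅y⁆)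

three-members⇒3≤∣p∣ : ∀ {m} {p : Subset m} {x y z : Fin m} →
  x ∈ p → y ∈ p → z ∈ p → x ≢ y → x ≢ z → y ≢ z → 3 ≤ ∣ p ∣
three-members⇒3≤∣p∣ {p = p} {x} {y} {z} x∈p y∈p z∈p x≢y x≢z y≢z =
  ≤-trans (s≤s 2≤∣p-x∣) (x∈p⇒∣p-x∣<∣p∣ x∈p)
  where
  y∈p-x : y ∈ p - x
  y∈p-x = x∈p∧x≢y⇒x∈p-y y∈p (λ e → x≢y (sym e))
  z∈p-x-y : z ∈ p - x - y
  z∈p-x-y = x∈p∧x≢y⇒x∈p-y (x∈p∧x≢y⇒x∈p-y z∈p (λ e → x≢z (sym e))) (λ e → y≢z (sym e))
  2≤∣p-x∣ : 2 ≤ ∣ p - x ∣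
  2≤∣p-x∣ = ≤-trans (s≤s (≤-trans (s≤s z≤n) (x∈p⇒∣p-x∣<∣p∣ z∈p-x-y))) (x∈p⇒∣p-x∣<∣p∣ y∈p-x)

module _ {V : Set} (_~_ : V → V → Set) where

  Dominates : V → V → Set
  Dominates u v = u ≡ v ⊎ u ~ v

  DominatedBy : (V → Set) → Set
  DominatedBy P = ∀ v → ∃[ u ] (P u × Dominates u v)

  DominatingEdge : V → V → Set
  DominatingEdge p q = p ~ q × (∀ v → Dominates p v ⊎ Dominates q v)

  HasDominatingEdge : Set
  HasDominatingEdge = ∃₂ DominatingEdge

  AddEdge : V → V → V → V → Set
  AddEdge U W u v = u ~ v ⊎ ((u ≡ U × v ≡ W) ⊎ (u ≡ W × v ≡ U))

  data ThreeWitness (P : V → Set) : Set where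
    nonadjacent-pair : ∀ {y z} → P y → P z → y ≢ z → ¬ y ~ z → ThreeWitness P
    distinct-triple  : ∀ {y z w} → P y → P z → P w → y ≢ z → y ≢ w → z ≢ w → ThreeWitness P

module _ {V : Set} {_~_ _≈_ : V → V → Set} where

  dominates-mono : (∀ {u v} → u ~ v → u ≈ v) → ∀ {u v} → Dominates _~_ u v → Dominates _≈_ u v
  dominates-mono ~⇒≈ (inj₁ u≡v) = inj₁ u≡v
  dominates-mono ~⇒≈ (inj₂ u~v) = inj₂ (~⇒≈ u~v)

  has-dominating-edge-mono : (∀ {u v} → u ~ v → u ≈ v) → HasDominatingEdge _~_ → HasDominatingEdge _≈_
  has-dominating-edge-mono ~⇒≈ (p , q , p~q , dom) = p , q , ~⇒≈ p~q , dominated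
    where
    dominated : ∀ v → Dominates _≈_ p v ⊎ Dominates _≈_ q v
    dominated v with dom v
    ... | inj₁ p≼v = inj₁ (dominates-mono ~⇒≈ p≼v)
    ... | inj₂ q≼v = inj₂ (dominates-mono ~⇒≈ q≼v)

AddEdge-comm : ∀ {V} {_~_ : V → V → Set} {U W u v} → AddEdge _~_ U W u v → AddEdge _~_ W U u v
AddEdge-comm (inj₁ u~v)        = inj₁ u~v
AddEdge-comm (inj₂ (inj₁ eqs)) = inj₂ (inj₂ eqs)
AddEdge-comm (inj₂ (inj₂ eqs)) = inj₂ (inj₁ eqs)

module _ (G : Graph) where

  _++ʷ_ : ∀ {D u w v} → WalkIn G D u w → WalkIn G D w v → WalkIn G D u v
  here           ++ʷ walk′ = walk′
  step u~ w∈D walk ++ʷ walk′ = step u~ w∈D (walk ++ʷ walk′)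

  member-dominates : ∀ {D u v} → u ∈ D → Dominates (Adj G) u v → v ∈ D ⊎ ∃[ w ] (w ∈ D × Adj G w v)
  member-dominates u∈D (inj₁ refl) = inj₁ u∈D
  member-dominates u∈D (inj₂ u~v)  = inj₂ (_ , u∈D , u~v)

  hub-connected : ∀ {D h} → h ∈ D → (∀ {v} → v ∈ D → v ≡ h ⊎ Adj G h v) → InducedConnected G D
  hub-connected {D} {h} h∈D spoke u v u∈D v∈D = to-hub (spoke u∈D) ++ʷ from-hub v∈D (spoke v∈D)
    where
    to-hub : ∀ {w} → w ≡ h ⊎ Adj G h w → WalkIn G D w h
    to-hub (inj₁ refl) = here
    to-hub (inj₂ h~w)  = step (adj-sym G h~w) h∈D here
    from-hub : ∀ {w} → w ∈ D → w ≡ h ⊎ Adj G h w → WalkIn G D h w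
    from-hub w∈D (inj₁ refl) = here
    from-hub w∈D (inj₂ h~w)  = step h~w w∈D here

  nonadjacent-members⇒3≤∣D∣ : ∀ {D y z} → InducedConnected G D →
    y ∈ D → z ∈ D → y ≢ z → ¬ Adj G y z → 3 ≤ ∣ D ∣
  nonadjacent-members⇒3≤∣D∣ {D} {y} {z} connected y∈D z∈D y≢z y≁z =
    leave (connected y z y∈D z∈D) refl
    where
    leave : ∀ {v} → WalkIn G D y v → v ≡ z → 3 ≤ ∣ D ∣
    leave here y≡z = ⊥-elim (y≢z y≡z)
    leave (step y~w w∈D _) _ =
      three-members⇒3≤∣p∣ y∈D z∈D w∈D y≢z
        (λ { refl → irrefl G y~w }) (λ { refl → y≁z y~w })

module Transport (H : Graph) {V : Set} (_~_ : V → V → Set) (ι : Fin (n H) ↔ V)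
  (reflect : ∀ {u w} → Inverse.to ι u ~ Inverse.to ι w → Adj H u w) where
  open Inverse ι using (to; from; strictlyInverseˡ; strictlyInverseʳ)

  to-injective : ∀ {u w} → to u ≡ to w → u ≡ w
  to-injective = Injection.injective (↔⇒↣ ι)

  from-injective : ∀ {p q} → from p ≡ from q → p ≡ q
  from-injective = Injection.injective (↔⇒↣ (↔-sym ι))

  reflect-from : ∀ {p q} → p ~ q → Adj H (from p) (from q)
  reflect-from {p} {q} p~q = reflect (subst₂ _~_ (sym (strictlyInverseˡ p)) (sym (strictlyInverseˡ q)) p~q)

  pull-dominates : ∀ {p w} → Dominates _~_ p (to w) → Dominates (Adj H) (from p) w
  pull-dominates {w = w} (inj₁ refl) = inj₁ (strictlyInverseʳ w)
  pull-dominates {p} {w} (inj₂ p~w)  = inj₂ (subst (Adj H (from p)) (strictlyInverseʳ w) (reflect-from p~w))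

  dominating-edge⇒γc<3 : HasDominatingEdge _~_ → γc< H 3
  dominating-edge⇒γc<3 (p , q , p~q , dom) =
    D , (dominating , hub-connected H (x∈⁅x⁆∪⁅y⁆ _ _) spoke) , s≤s (∣⁅x⁆∪⁅y⁆∣≤2 (from p) (from q))
    where
    D : Subset (n H)
    D = ⁅ from p ⁆ ∪ ⁅ from q ⁆
    dominating : Dominating H D
    dominating w with dom (to w)
    ... | inj₁ p≼w = member-dominates H (x∈⁅x⁆∪⁅y⁆ _ _) (pull-dominates p≼w)
    ... | inj₂ q≼w = member-dominates H (y∈⁅x⁆∪⁅y⁆ _ _) (pull-dominates q≼w)
    spoke : ∀ {v} → v ∈ D → v ≡ from p ⊎ Adj H (from p) v
    spoke v∈D with ∈⁅x⁆∪⁅y⁆⇒ v∈D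
    ... | inj₁ v≡p  = inj₁ v≡p
    ... | inj₂ refl = inj₂ (reflect-from p~q)

  dominating-path⇒γc≤3 : ∀ {p q r} → p ~ q → q ~ r →
    (∀ v → Dominates _~_ p v ⊎ Dominates _~_ q v ⊎ Dominates _~_ r v) →
    ∃[ D ] (IsCDS H D × ∣ D ∣ ≤ 3)
  dominating-path⇒γc≤3 {p} {q} {r} p~q q~r dom =
    D , (dominating , hub-connected H q∈D spoke) , ∣⁅x⁆∪⁅y⁆∪⁅z⁆∣≤3 (from p) (from q) (from r)
    where
    D : Subset (n H)
    D = ⁅ from p ⁆ ∪ ⁅ from q ⁆ ∪ ⁅ from r ⁆
    p∈D : from p ∈ D
    p∈D = x∈p∪q⁺ (inj₁ (x∈⁅x⁆ _))
    q∈D : from q ∈ D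
    q∈D = x∈p∪q⁺ (inj₂ (x∈⁅x⁆∪⁅y⁆ _ _))
    r∈D : from r ∈ D
    r∈D = x∈p∪q⁺ (inj₂ (y∈⁅x⁆∪⁅y⁆ _ _))
    dominating : Dominating H D
    dominating w with dom (to w)
    ... | inj₁ p≼w        = member-dominates H p∈D (pull-dominates p≼w)
    ... | inj₂ (inj₁ q≼w) = member-dominates H q∈D (pull-dominates q≼w)
    ... | inj₂ (inj₂ r≼w) = member-dominates H r∈D (pull-dominates r≼w)
    spoke : ∀ {v} → v ∈ D → v ≡ from q ⊎ Adj H (from q) v
    spoke v∈D with x∈p∪q⁻ ⁅ from p ⁆ _ v∈D
    ... | inj₁ v∈⁅p⁆ rewrite x∈⁅y⁆⇒x≡y _ v∈⁅p⁆ = inj₂ (adj-sym H (reflect-from p~q))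
    ... | inj₂ v∈⁅q⁆∪⁅r⁆ with ∈⁅x⁆∪⁅y⁆⇒ v∈⁅q⁆∪⁅r⁆
    ...   | inj₁ v≡q  = inj₁ v≡q
    ...   | inj₂ refl = inj₂ (reflect-from q~r)

  module _ (preserve : ∀ {u w} → Adj H u w → to u ~ to w) where

    dominating⇒dominated : ∀ {D} → Dominating H D → DominatedBy _~_ (λ v → from v ∈ D)
    dominating⇒dominated {D} dominating v with dominating (from v)
    ... | inj₁ v∈D = v , v∈D , inj₁ refl
    ... | inj₂ (u , u∈D , u~v) =
      to u , subst (_∈ D) (sym (strictlyInverseʳ u)) u∈D ,
      inj₂ (subst (to u ~_) (strictlyInverseˡ v) (preserve u~v))

    three-witness⇒3≤∣D∣ : ∀ {D} → InducedConnected H D → ThreeWitness _~_ (λ v → from v ∈ D) → 3 ≤ ∣ D ∣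
    three-witness⇒3≤∣D∣ connected (nonadjacent-pair {y} {z} y∈D z∈D y≢z y≁z) =
      nonadjacent-members⇒3≤∣D∣ H connected y∈D z∈D (λ e → y≢z (from-injective e))
        (λ y~z → y≁z (subst₂ _~_ (strictlyInverseˡ y) (strictlyInverseˡ z) (preserve y~z)))
    three-witness⇒3≤∣D∣ connected (distinct-triple y∈D z∈D w∈D y≢z y≢w z≢w) =
      three-members⇒3≤∣p∣ y∈D z∈D w∈D
        (λ e → y≢z (from-injective e)) (λ e → y≢w (from-injective e)) (λ e → z≢w (from-injective e))

    cds-size-≥3 : (∀ {P} → DominatedBy _~_ P → ThreeWitness _~_ P) → ∀ D → IsCDS H D → 3 ≤ ∣ D ∣
    cds-size-≥3 witness D (dominating , connected) =
      three-witness⇒3≤∣D∣ connected (witness (dominating⇒dominated dominating))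

module _ (H : Graph) {V : Set} (_~_ : V → V → Set) (ι : Fin (n H) ↔ V)
  (reflect : ∀ {u w} → Inverse.to ι u ~ Inverse.to ι w → Adj H u w) where
  open Inverse ι using (to)
  open Transport H _~_ ι reflect using (to-injective)

  added-edge⇒γc<3 : ∀ {u v} (u≢v : u ≢ v) → HasDominatingEdge (AddEdge _~_ (to u) (to v)) →
    γc< (addEdge H u v u≢v) 3
  added-edge⇒γc<3 {u} {v} u≢v =
    Transport.dominating-edge⇒γc<3 (addEdge H u v u≢v) (AddEdge _~_ (to u) (to v)) ι reflect⁺
    where
    reflect⁺ : ∀ {u′ v′} → AddEdge _~_ (to u) (to v) (to u′) (to v′) → Adj (addEdge H u v u≢v) u′ v′
    reflect⁺ (inj₁ u′~v′)              = inj₁ (reflect u′~v′)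
    reflect⁺ (inj₂ (inj₁ (u′≡u , v′≡v))) = inj₂ (inj₁ (to-injective u′≡u , to-injective v′≡v))
    reflect⁺ (inj₂ (inj₂ (u′≡v , v′≡u))) = inj₂ (inj₂ (to-injective u′≡v , to-injective v′≡u))

module 𝒢₁-Structure (s : ℕ) (b : Fin s → ℕ) (β : Construction.BIndex s b)
  (β∈B₀ : toℕ (proj₁ β) ≡ 0) (s≥2 : 2 ≤ s) (b≥1 : ∀ j → 1 ≤ b j) where
  open Construction s b

  -- a record, because  AdjC  computes and would otherwise hide its endpoints from unification
  record _~_ (u v : Vtx) : Set where
    constructor edge
    field adjC : AdjC β u v

  -- b⋆ is the vertex b ∈ B₀ of the construction; the name b is taken by the sizes b_j.
  a₀ aₛ b⋆ : Vtx
  a₀ = a fzero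
  aₛ = a (fromℕ s)
  b⋆ = bv (proj₁ β) (proj₂ β)

  rep : Fin s → Vtx
  rep j = bv j (fromℕ< (b≥1 j))

  j₁ : Fin s
  j₁ = fromℕ< s≥2

  1≤j₁ : 1 ≤ toℕ j₁
  1≤j₁ = subst (1 ≤_) (sym (toℕ-fromℕ< s≥2)) ≤-refl

  0<s : 0 < s
  0<s = ≤-trans (s≤s z≤n) s≥2

  data ARole (i : Fin (suc s)) : Set where
    first  : toℕ i ≡ 0 → ARole i
    middle : 1 ≤ toℕ i → toℕ i < s → ARole i
    final  : toℕ i ≡ s → ARole i

  aRole : ∀ i → ARole i
  aRole i with toℕ i ≟ⁿ 0 | toℕ i ≟ⁿ s
  ... | yes i≡0 | _       = first i≡0
  ... | no _    | yes i≡s = final i≡s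
  ... | no i≢0  | no i≢s  = middle (n≢0⇒n>0 i≢0) (≤∧≢⇒< (toℕ≤pred[n] i) i≢s)

  data BRole (j : Fin s) : Set where
    inB₀ : toℕ j ≡ 0 → BRole j
    inB⁺ : 1 ≤ toℕ j → BRole j

  bRole : ∀ j → BRole j
  bRole j with toℕ j ≟ⁿ 0
  ... | yes j≡0 = inB₀ j≡0
  ... | no j≢0  = inB⁺ (n≢0⇒n>0 j≢0)

  a≡a : ∀ {i k} → toℕ i ≡ toℕ k → a i ≡ a k
  a≡a i≡k = cong a (toℕ-injective i≡k)

  first<s : ∀ {m} → m ≡ 0 → m < s
  first<s m≡0 = subst (_< s) (sym m≡0) 0<s

  ~-sym : ∀ {u v} → u ~ v → v ~ u
  ~-sym (edge (inj₁ e)) = edge (inj₂ e)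
  ~-sym (edge (inj₂ e)) = edge (inj₁ e)

  a~x : ∀ {i} → toℕ i < s → a i ~ x
  a~x i<s = edge (inj₁ i<s)

  a₀~b : ∀ {i j k} → toℕ i ≡ 0 → a i ~ bv j k
  a₀~b i≡0 = edge (inj₁ (inj₁ i≡0))

  a~b : ∀ {i j k} → toℕ i < s → toℕ j ≢ toℕ i → a i ~ bv j k
  a~b i<s j≢i = edge (inj₁ (inj₂ (inj₁ (i<s , j≢i))))

  aₛ~b : ∀ {i j k} → toℕ i ≡ s → 1 ≤ toℕ j → a i ~ bv j k
  aₛ~b i≡s 1≤j = edge (inj₁ (inj₂ (inj₂ (i≡s , 1≤j))))

  x~b : ∀ {j k} → (j , k) ≢ β → x ~ bv j k
  x~b jk≢β = edge (inj₁ jk≢β)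

  x~B⁺ : ∀ {j k} → 1 ≤ toℕ j → x ~ bv j k
  x~B⁺ 1≤j = x~b λ { refl → n>0⇒n≢0 1≤j β∈B₀ }

  B₀-clique : ∀ {j k j′ k′} → toℕ j ≡ 0 → toℕ j′ ≡ 0 → Dominates _~_ (bv j k) (bv j′ k′)
  B₀-clique {j} {k} {j′} {k′} j≡0 j′≡0 with ≡-dec _≟ᶠ_ _≟ᶠ_ (j , k) (j′ , k′)
  ... | yes refl = inj₁ refl
  ... | no jk≢   = inj₂ (edge (inj₁ (jk≢ , inj₂ (j≡0 , j′≡0))))

  B⁺-clique : ∀ {j k j′ k′} → 1 ≤ toℕ j → 1 ≤ toℕ j′ → Dominates _~_ (bv j k) (bv j′ k′)
  B⁺-clique {j} {k} {j′} {k′} 1≤j 1≤j′ with ≡-dec _≟ᶠ_ _≟ᶠ_ (j , k) (j′ , k′)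
  ... | yes refl = inj₁ refl
  ... | no jk≢   = inj₂ (edge (inj₁ (jk≢ , inj₁ (1≤j , 1≤j′))))

  B⁺~a : ∀ {i j k} → 1 ≤ toℕ j → toℕ j ≢ toℕ i → bv j k ~ a i
  B⁺~a {i} 1≤j j≢i with aRole i
  ... | first i≡0    = ~-sym (a~b (first<s i≡0) j≢i)
  ... | middle _ i<s = ~-sym (a~b i<s j≢i)
  ... | final i≡s    = ~-sym (aₛ~b i≡s 1≤j)

  B₀~a : ∀ {i j k} → toℕ j ≡ 0 → toℕ i < s → bv j k ~ a i
  B₀~a {i} j≡0 i<s with aRole i
  ... | first i≡0      = ~-sym (a₀~b i≡0)
  ... | middle 1≤i i<s = ~-sym (a~b i<s λ j≡i → n>0⇒n≢0 1≤i (trans (sym j≡i) j≡0))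
  ... | final i≡s      = ⊥-elim (<-irrefl i≡s i<s)

  a≁a : ∀ {i k} → ¬ a i ~ a k
  a≁a (edge (inj₁ ()))
  a≁a (edge (inj₂ ()))

  aᵢ≁Bᵢ : ∀ {i j k} → 1 ≤ toℕ j → toℕ j ≡ toℕ i → ¬ a i ~ bv j k
  aᵢ≁Bᵢ 1≤j j≡i (edge (inj₁ (inj₁ i≡0)))                = n>0⇒n≢0 1≤j (trans j≡i i≡0)
  aᵢ≁Bᵢ 1≤j j≡i (edge (inj₁ (inj₂ (inj₁ (_ , j≢i)))))   = j≢i j≡i
  aᵢ≁Bᵢ {j = j} 1≤j j≡i (edge (inj₁ (inj₂ (inj₂ (i≡s , _))))) = <-irrefl (trans j≡i i≡s) (toℕ<n j)
  aᵢ≁Bᵢ 1≤j j≡i (edge (inj₂ ()))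

  B₀≁aₛ : ∀ {i j k} → toℕ j ≡ 0 → toℕ i ≡ s → ¬ bv j k ~ a i
  B₀≁aₛ j≡0 i≡s (edge (inj₁ ()))
  B₀≁aₛ j≡0 i≡s (edge (inj₂ (inj₁ i≡0)))               = n>0⇒n≢0 0<s (trans (sym i≡s) i≡0)
  B₀≁aₛ j≡0 i≡s (edge (inj₂ (inj₂ (inj₁ (i<s , _)))))  = <-irrefl i≡s i<s
  B₀≁aₛ j≡0 i≡s (edge (inj₂ (inj₂ (inj₂ (_ , 1≤j)))))  = n>0⇒n≢0 1≤j j≡0

  B₀≁B⁺ : ∀ {j k j′ k′} → toℕ j ≡ 0 → 1 ≤ toℕ j′ → ¬ bv j k ~ bv j′ k′
  B₀≁B⁺ j≡0 1≤j′ (edge (inj₁ (_ , inj₁ (1≤j , _))))  = n>0⇒n≢0 1≤j j≡0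
  B₀≁B⁺ j≡0 1≤j′ (edge (inj₁ (_ , inj₂ (_ , j′≡0)))) = n>0⇒n≢0 1≤j′ j′≡0
  B₀≁B⁺ j≡0 1≤j′ (edge (inj₂ (_ , inj₁ (_ , 1≤j)))) = n>0⇒n≢0 1≤j j≡0
  B₀≁B⁺ j≡0 1≤j′ (edge (inj₂ (_ , inj₂ (j′≡0 , _)))) = n>0⇒n≢0 1≤j′ j′≡0

  -- Y ⊇ N[b⋆] and Z ⊇ N[aₛ] are disjoint, and the only edges between them join
  -- some aᵢ (i < s) to some Bⱼ with j ∉ {0, i}; then aⱼ needs a third dominator.
  data Y : Vtx → Set where
    y-a : ∀ {i} → toℕ i < s → Y (a i)
    y-b : ∀ {j k} → toℕ j ≡ 0 → Y (bv j k)

  data Z : Vtx → Set where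
    z-a : ∀ {i} → toℕ i ≡ s → Z (a i)
    z-b : ∀ {j k} → 1 ≤ toℕ j → Z (bv j k)

  Y∋dominator-of-b⋆ : ∀ {u} → Dominates _~_ u b⋆ → Y u
  Y∋dominator-of-b⋆ (inj₁ refl) = y-b β∈B₀
  Y∋dominator-of-b⋆ {a i} (inj₂ (edge (inj₁ (inj₁ i≡0))))               = y-a (first<s i≡0)
  Y∋dominator-of-b⋆ {a i} (inj₂ (edge (inj₁ (inj₂ (inj₁ (i<s , _))))))  = y-a i<s
  Y∋dominator-of-b⋆ {a i} (inj₂ (edge (inj₁ (inj₂ (inj₂ (_ , 1≤j)))))) = ⊥-elim (n>0⇒n≢0 1≤j β∈B₀)
  Y∋dominator-of-b⋆ {a i} (inj₂ (edge (inj₂ ())))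
  Y∋dominator-of-b⋆ {x} (inj₂ (edge (inj₁ b⋆≢β))) = ⊥-elim (b⋆≢β refl)
  Y∋dominator-of-b⋆ {x} (inj₂ (edge (inj₂ ())))
  Y∋dominator-of-b⋆ {bv j k} (inj₂ (edge (inj₁ (_ , inj₁ (_ , 1≤β)))))  = ⊥-elim (n>0⇒n≢0 1≤β β∈B₀)
  Y∋dominator-of-b⋆ {bv j k} (inj₂ (edge (inj₁ (_ , inj₂ (j≡0 , _)))))  = y-b j≡0
  Y∋dominator-of-b⋆ {bv j k} (inj₂ (edge (inj₂ (_ , inj₁ (1≤β , _)))))  = ⊥-elim (n>0⇒n≢0 1≤β β∈B₀)
  Y∋dominator-of-b⋆ {bv j k} (inj₂ (edge (inj₂ (_ , inj₂ (_ , j≡0)))))  = y-b j≡0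

  Z∋dominator-of-aₛ : ∀ {u} → Dominates _~_ u aₛ → Z u
  Z∋dominator-of-aₛ (inj₁ refl) = z-a (toℕ-fromℕ s)
  Z∋dominator-of-aₛ {a i} (inj₂ i~aₛ) = ⊥-elim (a≁a i~aₛ)
  Z∋dominator-of-aₛ {x} (inj₂ (edge (inj₁ ())))
  Z∋dominator-of-aₛ {x} (inj₂ (edge (inj₂ s<s))) = ⊥-elim (<-irrefl (toℕ-fromℕ s) s<s)
  Z∋dominator-of-aₛ {bv j k} (inj₂ (edge (inj₁ ())))
  Z∋dominator-of-aₛ {bv j k} (inj₂ (edge (inj₂ (inj₁ s≡0)))) =
    ⊥-elim (n>0⇒n≢0 0<s (trans (sym (toℕ-fromℕ s)) s≡0))
  Z∋dominator-of-aₛ {bv j k} (inj₂ (edge (inj₂ (inj₂ (inj₁ (s<s , _)))))) =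
    ⊥-elim (<-irrefl (toℕ-fromℕ s) s<s)
  Z∋dominator-of-aₛ {bv j k} (inj₂ (edge (inj₂ (inj₂ (inj₂ (_ , 1≤j)))))) = z-b 1≤j

  Y∩Z≡∅ : ∀ {y z} → Y y → Z z → y ≢ z
  Y∩Z≡∅ (y-a i<s) (z-a i≡s) refl = <-irrefl i≡s i<s
  Y∩Z≡∅ (y-b j≡0) (z-b 1≤j) refl = n>0⇒n≢0 1≤j j≡0

  dominated⇒three-witness : ∀ {P} → DominatedBy _~_ P → ThreeWitness _~_ P
  dominated⇒three-witness {P} dominated with dominated b⋆ | dominated aₛ
  ... | y , Py , y≼b⋆ | z , Pz , z≼aₛ =
    separate (Y∋dominator-of-b⋆ y≼b⋆) (Z∋dominator-of-aₛ z≼aₛ) Py Pz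
    where
    separate : ∀ {y z} → Y y → Z z → P y → P z → ThreeWitness _~_ P
    separate Yy@(y-a _) Zz@(z-a _) Py Pz = nonadjacent-pair Py Pz (Y∩Z≡∅ Yy Zz) a≁a
    separate Yy@(y-b j≡0) Zz@(z-a i≡s) Py Pz = nonadjacent-pair Py Pz (Y∩Z≡∅ Yy Zz) (B₀≁aₛ j≡0 i≡s)
    separate Yy@(y-b j≡0) Zz@(z-b 1≤j′) Py Pz = nonadjacent-pair Py Pz (Y∩Z≡∅ Yy Zz) (B₀≁B⁺ j≡0 1≤j′)
    separate Yy@(y-a {i} _) Zz@(z-b {j} {k} 1≤j) Py Pz with toℕ j ≟ⁿ toℕ i | dominated (a (inject₁ j))
    ... | yes j≡i | _ = nonadjacent-pair Py Pz (Y∩Z≡∅ Yy Zz) (aᵢ≁Bᵢ 1≤j j≡i)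
    ... | no j≢i | w , Pw , w≼aⱼ = distinct-triple Py Pz Pw (Y∩Z≡∅ Yy Zz) (aᵢ≢w w≼aⱼ) (bⱼ≢w w≼aⱼ)
      where
      aᵢ≢w : ∀ {w} → Dominates _~_ w (a (inject₁ j)) → a i ≢ w
      aᵢ≢w (inj₁ refl) refl = j≢i (sym (toℕ-inject₁ j))
      aᵢ≢w (inj₂ w~aⱼ) refl = a≁a w~aⱼ
      bⱼ≢w : ∀ {w} → Dominates _~_ w (a (inject₁ j)) → bv j k ≢ w
      bⱼ≢w (inj₁ ()) refl
      bⱼ≢w (inj₂ w~aⱼ) refl = aᵢ≁Bᵢ 1≤j (sym (toℕ-inject₁ j)) (~-sym w~aⱼ)

  a₀-x-B₁-dominate : ∀ v → Dominates _~_ a₀ v ⊎ Dominates _~_ x v ⊎ Dominates _~_ (rep j₁) v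
  a₀-x-B₁-dominate (a i) with aRole i
  ... | first i≡0    = inj₁ (inj₁ (a≡a (sym i≡0)))
  ... | middle _ i<s = inj₂ (inj₁ (inj₂ (~-sym (a~x i<s))))
  ... | final i≡s    = inj₂ (inj₂ (inj₂ (~-sym (aₛ~b i≡s 1≤j₁))))
  a₀-x-B₁-dominate x        = inj₂ (inj₁ (inj₁ refl))
  a₀-x-B₁-dominate (bv j k) = inj₁ (inj₂ (a₀~b refl))

  module _ {U W : Vtx} where

    old-edge : ∀ {u v} → u ~ v → Dominates (AddEdge _~_ U W) u v
    old-edge u~v = inj₂ (inj₁ u~v)

    old-dominates : ∀ {u v} → Dominates _~_ u v → Dominates (AddEdge _~_ U W) u v
    old-dominates = dominates-mono {_~_ = _~_} {_≈_ = AddEdge _~_ U W} inj₁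

    new-edge : ∀ {v} → v ≡ W → Dominates (AddEdge _~_ U W) U v
    new-edge refl = inj₂ (inj₂ (inj₁ (refl , refl)))

    new-edge′ : ∀ {v} → v ≡ U → Dominates (AddEdge _~_ U W) W v
    new-edge′ refl = inj₂ (inj₂ (inj₂ (refl , refl)))

  aᵢ-x-dominate-all-but-aₛ : ∀ {i} → toℕ i < s →
    ∀ v → Dominates _~_ (a i) v ⊎ Dominates _~_ x v ⊎ ∃[ k ] (toℕ k ≡ s × v ≡ a k)
  aᵢ-x-dominate-all-but-aₛ i<s (a i′) with aRole i′
  ... | first i′≡0    = inj₂ (inj₁ (inj₂ (~-sym (a~x (first<s i′≡0)))))
  ... | middle _ i′<s = inj₂ (inj₁ (inj₂ (~-sym (a~x i′<s))))
  ... | final i′≡s    = inj₂ (inj₂ (i′ , i′≡s , refl))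
  aᵢ-x-dominate-all-but-aₛ i<s x = inj₂ (inj₁ (inj₁ refl))
  aᵢ-x-dominate-all-but-aₛ {i} i<s (bv j k) with toℕ j ≟ⁿ toℕ i | bRole j
  ... | no j≢i  | _        = inj₁ (inj₂ (a~b i<s j≢i))
  ... | yes j≡i | inB₀ j≡0 = inj₁ (inj₂ (a₀~b (trans (sym j≡i) j≡0)))
  ... | yes _   | inB⁺ 1≤j = inj₂ (inj₁ (inj₂ (x~B⁺ 1≤j)))

  rescue-aᵢaₛ : ∀ {i k} → toℕ i < s → toℕ k ≡ s → HasDominatingEdge (AddEdge _~_ (a i) (a k))
  rescue-aᵢaₛ {i} {k} i<s k≡s = a i , x , inj₁ (a~x i<s) , dominate
    where
    dominate : ∀ v → Dominates (AddEdge _~_ (a i) (a k)) (a i) v ⊎ Dominates (AddEdge _~_ (a i) (a k)) x v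
    dominate v with aᵢ-x-dominate-all-but-aₛ i<s v
    ... | inj₁ aᵢ≼v                    = inj₁ (old-dominates aᵢ≼v)
    ... | inj₂ (inj₁ x≼v)              = inj₂ (old-dominates x≼v)
    ... | inj₂ (inj₂ (_ , k′≡s , refl)) = inj₁ (new-edge (a≡a (trans k′≡s (sym k≡s))))

  rescue-aₛx : ∀ {k} → toℕ k ≡ s → HasDominatingEdge (AddEdge _~_ (a k) x)
  rescue-aₛx {k} k≡s = a₀ , x , inj₁ (a~x 0<s) , dominate
    where
    dominate : ∀ v → Dominates (AddEdge _~_ (a k) x) a₀ v ⊎ Dominates (AddEdge _~_ (a k) x) x v
    dominate v with aᵢ-x-dominate-all-but-aₛ 0<s v
    ... | inj₁ a₀≼v                    = inj₁ (old-dominates a₀≼v)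
    ... | inj₂ (inj₁ x≼v)              = inj₂ (old-dominates x≼v)
    ... | inj₂ (inj₂ (_ , k′≡s , refl)) = inj₂ (new-edge′ (a≡a (trans k′≡s (sym k≡s))))

  rescue-aa : ∀ {i k} → toℕ i < s → 1 ≤ toℕ k → toℕ k < s → i ≢ k →
    HasDominatingEdge (AddEdge _~_ (a i) (a k))
  rescue-aa {i} {k} i<s 1≤k k<s i≢k = a i , rep kᴮ , inj₁ (a~b i<s kᴮ≢i) , dominate
    where
    kᴮ : Fin s
    kᴮ = fromℕ< k<s
    kᴮ≡k : toℕ kᴮ ≡ toℕ k
    kᴮ≡k = toℕ-fromℕ< k<s
    kᴮ≢i : toℕ kᴮ ≢ toℕ i
    kᴮ≢i e = i≢k (toℕ-injective (trans (sym e) kᴮ≡k))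
    1≤kᴮ : 1 ≤ toℕ kᴮ
    1≤kᴮ = subst (1 ≤_) (sym kᴮ≡k) 1≤k
    R⁺ : Vtx → Vtx → Set
    R⁺ = AddEdge _~_ (a i) (a k)
    dominate : ∀ v → Dominates R⁺ (a i) v ⊎ Dominates R⁺ (rep kᴮ) v
    dominate (a i′) with i′ ≟ᶠ i | i′ ≟ᶠ k
    ... | yes refl | _        = inj₁ (inj₁ refl)
    ... | no _     | yes refl = inj₁ (new-edge refl)
    ... | no _     | no i′≢k  = inj₂ (old-edge (B⁺~a 1≤kᴮ λ e → i′≢k (toℕ-injective (trans (sym e) kᴮ≡k))))
    dominate x = inj₁ (old-edge (a~x i<s))
    dominate (bv j k′) with toℕ j ≟ⁿ toℕ i | bRole j
    ... | no j≢i  | _        = inj₁ (old-edge (a~b i<s j≢i))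
    ... | yes j≡i | inB₀ j≡0 = inj₁ (old-edge (a₀~b (trans (sym j≡i) j≡0)))
    ... | yes _   | inB⁺ 1≤j = inj₂ (old-dominates (B⁺-clique 1≤kᴮ 1≤j))

  rescue-aᵢBᵢ : ∀ {i j k} → 1 ≤ toℕ i → toℕ i < s → toℕ j ≡ toℕ i →
    HasDominatingEdge (AddEdge _~_ (a i) (bv j k))
  rescue-aᵢBᵢ {i} {j} {k} 1≤i i<s j≡i = a i , bv j k , inj₂ (inj₁ (refl , refl)) , dominate
    where
    1≤j : 1 ≤ toℕ j
    1≤j = subst (1 ≤_) (sym j≡i) 1≤i
    R⁺ : Vtx → Vtx → Set
    R⁺ = AddEdge _~_ (a i) (bv j k)
    dominate : ∀ v → Dominates R⁺ (a i) v ⊎ Dominates R⁺ (bv j k) v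
    dominate (a i′) with i′ ≟ᶠ i
    ... | yes refl = inj₁ (inj₁ refl)
    ... | no i′≢i  = inj₂ (old-edge (B⁺~a 1≤j λ e → i′≢i (toℕ-injective (trans (sym e) j≡i))))
    dominate x = inj₁ (old-edge (a~x i<s))
    dominate (bv j′ k′) with toℕ j′ ≟ⁿ toℕ i
    ... | no j′≢i  = inj₁ (old-edge (a~b i<s j′≢i))
    ... | yes j′≡i = inj₂ (old-dominates (B⁺-clique 1≤j (subst (1 ≤_) (sym j′≡i) 1≤i)))

  rescue-aₛB₀ : ∀ {i j k} → toℕ i ≡ s → toℕ j ≡ 0 → HasDominatingEdge (AddEdge _~_ (a i) (bv j k))
  rescue-aₛB₀ {i} {j} {k} i≡s j≡0 = a₀ , bv j k , inj₁ (a₀~b refl) , dominate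
    where
    R⁺ : Vtx → Vtx → Set
    R⁺ = AddEdge _~_ (a i) (bv j k)
    dominate : ∀ v → Dominates R⁺ a₀ v ⊎ Dominates R⁺ (bv j k) v
    dominate (a i′) with aRole i′
    ... | first i′≡0     = inj₁ (inj₁ (a≡a (sym i′≡0)))
    ... | middle _ i′<s  = inj₂ (old-edge (B₀~a j≡0 i′<s))
    ... | final i′≡s     = inj₂ (new-edge′ (a≡a (trans i′≡s (sym i≡s))))
    dominate x          = inj₁ (old-edge (a~x 0<s))
    dominate (bv j′ k′) = inj₁ (old-edge (a₀~b refl))

  rescue-xb⋆ : ∀ {j k} → (j , k) ≡ β → HasDominatingEdge (AddEdge _~_ x (bv j k))
  rescue-xb⋆ {j} {k} jk≡β = x , rep j₁ , inj₁ (x~B⁺ 1≤j₁) , dominate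
    where
    R⁺ : Vtx → Vtx → Set
    R⁺ = AddEdge _~_ x (bv j k)
    dominate : ∀ v → Dominates R⁺ x v ⊎ Dominates R⁺ (rep j₁) v
    dominate (a i′) with aRole i′
    ... | first i′≡0    = inj₁ (old-edge (~-sym (a~x (first<s i′≡0))))
    ... | middle _ i′<s = inj₁ (old-edge (~-sym (a~x i′<s)))
    ... | final i′≡s    = inj₂ (old-edge (~-sym (aₛ~b i′≡s 1≤j₁)))
    dominate x = inj₁ (inj₁ refl)
    dominate (bv j′ k′) with ≡-dec _≟ᶠ_ _≟ᶠ_ (j′ , k′) β
    ... | no j′k′≢β = inj₁ (old-edge (x~b j′k′≢β))
    ... | yes j′k′≡β with trans j′k′≡β (sym jk≡β)
    ...   | refl = inj₁ (new-edge refl)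

  rescue-B₀B⁺ : ∀ {j k j′ k′} → toℕ j ≡ 0 → 1 ≤ toℕ j′ →
    HasDominatingEdge (AddEdge _~_ (bv j k) (bv j′ k′))
  rescue-B₀B⁺ {j} {k} {j′} {k′} j≡0 1≤j′ = bv j k , bv j′ k′ , inj₂ (inj₁ (refl , refl)) , dominate
    where
    R⁺ : Vtx → Vtx → Set
    R⁺ = AddEdge _~_ (bv j k) (bv j′ k′)
    dominate : ∀ v → Dominates R⁺ (bv j k) v ⊎ Dominates R⁺ (bv j′ k′) v
    dominate (a i′) with toℕ j′ ≟ⁿ toℕ i′
    ... | no j′≢i′  = inj₂ (old-edge (B⁺~a 1≤j′ j′≢i′))
    ... | yes j′≡i′ = inj₁ (old-edge (B₀~a j≡0 (subst (_< s) j′≡i′ (toℕ<n j′))))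
    dominate x = inj₂ (old-edge (~-sym (x~B⁺ 1≤j′)))
    dominate (bv j″ k″) with bRole j″
    ... | inB₀ j″≡0 = inj₁ (old-dominates (B₀-clique j≡0 j″≡0))
    ... | inB⁺ 1≤j″ = inj₂ (old-dominates (B⁺-clique 1≤j′ 1≤j″))

  swap : ∀ {U W} → HasDominatingEdge (AddEdge _~_ W U) → HasDominatingEdge (AddEdge _~_ U W)
  swap {U} {W} = has-dominating-edge-mono {_~_ = AddEdge _~_ W U} {_≈_ = AddEdge _~_ U W} (AddEdge-comm {_~_ = _~_})

  critical-aa : ∀ {i k} → a i ≢ a k → HasDominatingEdge (AddEdge _~_ (a i) (a k))
  critical-aa {i} {k} aᵢ≢aₖ with aRole i | aRole k
  ... | first i≡0      | first k≡0      = ⊥-elim (aᵢ≢aₖ (a≡a (trans i≡0 (sym k≡0))))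
  ... | final i≡s      | final k≡s      = ⊥-elim (aᵢ≢aₖ (a≡a (trans i≡s (sym k≡s))))
  ... | first i≡0      | middle 1≤k k<s = rescue-aa (first<s i≡0) 1≤k k<s (λ e → aᵢ≢aₖ (cong a e))
  ... | middle _ i<s   | middle 1≤k k<s = rescue-aa i<s 1≤k k<s (λ e → aᵢ≢aₖ (cong a e))
  ... | middle 1≤i i<s | first k≡0      = swap (rescue-aa (first<s k≡0) 1≤i i<s (λ e → aᵢ≢aₖ (cong a (sym e))))
  ... | first i≡0      | final k≡s      = rescue-aᵢaₛ (first<s i≡0) k≡s
  ... | middle _ i<s   | final k≡s      = rescue-aᵢaₛ i<s k≡s
  ... | final i≡s      | first k≡0      = swap (rescue-aᵢaₛ (first<s k≡0) i≡s)
  ... | final i≡s      | middle _ k<s   = swap (rescue-aᵢaₛ k<s i≡s)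

  critical-ax : ∀ {i} → ¬ a i ~ x → HasDominatingEdge (AddEdge _~_ (a i) x)
  critical-ax {i} aᵢ≁x with aRole i
  ... | first i≡0    = ⊥-elim (aᵢ≁x (a~x (first<s i≡0)))
  ... | middle _ i<s = ⊥-elim (aᵢ≁x (a~x i<s))
  ... | final i≡s    = rescue-aₛx i≡s

  critical-ab : ∀ {i j k} → ¬ a i ~ bv j k → HasDominatingEdge (AddEdge _~_ (a i) (bv j k))
  critical-ab {i} {j} aᵢ≁b with aRole i | toℕ j ≟ⁿ toℕ i | bRole j
  ... | first i≡0      | _       | _        = ⊥-elim (aᵢ≁b (a₀~b i≡0))
  ... | middle 1≤i i<s | yes j≡i | _        = rescue-aᵢBᵢ 1≤i i<s j≡i
  ... | middle _ i<s   | no j≢i  | _        = ⊥-elim (aᵢ≁b (a~b i<s j≢i))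
  ... | final i≡s      | _       | inB₀ j≡0 = rescue-aₛB₀ i≡s j≡0
  ... | final i≡s      | _       | inB⁺ 1≤j = ⊥-elim (aᵢ≁b (aₛ~b i≡s 1≤j))

  critical-xb : ∀ {j k} → ¬ x ~ bv j k → HasDominatingEdge (AddEdge _~_ x (bv j k))
  critical-xb {j} {k} x≁b with ≡-dec _≟ᶠ_ _≟ᶠ_ (j , k) β
  ... | yes jk≡β = rescue-xb⋆ jk≡β
  ... | no jk≢β  = ⊥-elim (x≁b (x~b jk≢β))

  critical-bb : ∀ {j k j′ k′} → bv j k ≢ bv j′ k′ → ¬ bv j k ~ bv j′ k′ →
    HasDominatingEdge (AddEdge _~_ (bv j k) (bv j′ k′))
  critical-bb {j} {k} {j′} {k′} b≢b′ b≁b′ with bRole j | bRole j′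
  ... | inB₀ j≡0 | inB₀ j′≡0 = ⊥-elim ([ b≢b′ , b≁b′ ] (B₀-clique j≡0 j′≡0))
  ... | inB⁺ 1≤j | inB⁺ 1≤j′ = ⊥-elim ([ b≢b′ , b≁b′ ] (B⁺-clique 1≤j 1≤j′))
  ... | inB₀ j≡0 | inB⁺ 1≤j′ = rescue-B₀B⁺ j≡0 1≤j′
  ... | inB⁺ 1≤j | inB₀ j′≡0 = swap (rescue-B₀B⁺ j′≡0 1≤j)

  critical : ∀ U W → U ≢ W → ¬ U ~ W → HasDominatingEdge (AddEdge _~_ U W)
  critical (a i)    (a k)     U≢W _   = critical-aa U≢W
  critical (a i)    x         _   U≁W = critical-ax U≁W
  critical (a i)    (bv j k)  _   U≁W = critical-ab U≁W
  critical x        (a i)     _   U≁W = swap (critical-ax (λ r → U≁W (~-sym r)))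
  critical x        x         U≢W _   = ⊥-elim (U≢W refl)
  critical x        (bv j k)  _   U≁W = critical-xb U≁W
  critical (bv j k) (a i)     _   U≁W = swap (critical-ab (λ r → U≁W (~-sym r)))
  critical (bv j k) x         _   U≁W = swap (critical-xb (λ r → U≁W (~-sym r)))
  critical (bv j k) (bv j′ k′) U≢W U≁W = critical-bb U≢W U≁W

lemma3p3 : (s : ℕ) → 2 ≤ s → (b : Fin s → ℕ) → (∀ i → 1 ≤ b i) →
           (G : Graph) → In𝒢₁ s b G → ThreeCritical G
lemma3p3 s s≥2 b b≥1 G (β , β∈B₀ , f , adj⇔) = (minimum , lower) , critical-edge
  where
  open 𝒢₁-Structure s b β β∈B₀ s≥2 b≥1
  ι : Fin (n G) ↔ Construction.Vtx s b
  ι = ⤖⇒↔ f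
  open Inverse ι using (to)

  preserve : ∀ {u w} → Adj G u w → to u ~ to w
  preserve {u} {w} u~w = edge (Equivalence.to (adj⇔ u w) u~w)

  reflect : ∀ {u w} → to u ~ to w → Adj G u w
  reflect {u} {w} (edge u~w) = Equivalence.from (adj⇔ u w) u~w

  open Transport G _~_ ι reflect

  lower : ∀ D → IsCDS G D → 3 ≤ ∣ D ∣
  lower = cds-size-≥3 preserve dominated⇒three-witness

  minimum : ∃[ D ] (IsCDS G D × ∣ D ∣ ≡ 3)
  minimum with dominating-path⇒γc≤3 (a~x 0<s) (x~B⁺ 1≤j₁) a₀-x-B₁-dominate
  ... | D , cds , ∣D∣≤3 = D , cds , ≤-antisym ∣D∣≤3 (lower D cds)

  critical-edge : ∀ u v → (u≢v : u ≢ v) → ¬ Adj G u v → γc< (addEdge G u v u≢v) 3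
  critical-edge u v u≢v u≁v = added-edge⇒γc<3 G _~_ ι reflect u≢v
    (critical (to u) (to v) (λ e → u≢v (to-injective e)) (λ r → u≁v (reflect r)))
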